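{- Let $x^*,y^*$ be an optimal solution of the linear program (LP) for the generalized min-sum set cover instance $(U,\mathcal{S},K)$ with $|U|=n$, described in the context, and let $Q>0$. Define $x=(x_{e,t})_{e\in U,\,t\in[n]}$ by first setting $x:=Q\cdot x^*$ and then, for $t=1,2,\ldots,\lfloor n/2\rfloor$ in this order (always using the current values), setting $x_{e,2t}:=x_{e,2t}+x_{e,t}$ for every $e\in U$. Then: (i) for each $t\in[n]$, $\sum_{t'=1}^t\sum_{e\in U}x_{e,t'}\le 2\cdot Q\cdot t$; (ii) for each $e\in U$ and each $t\le\lfloor n/2\rfloor$, $\sum_{t'=t+1}^{2t}x_{e,t'}\ge Q\sum_{t'=1}^t x^*_{e,t'}$; (iii) for each $e\in U$ and each $t\in[n]$, $\sum_{t'=1}^{t}x_{e,t'}\ge Q\sum_{t'=1}^t x^*_{e,t'}$.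
   Context: Generalized min-sum set cover: given a universe $U$ of $n$ elements, a collection $\mathcal{S}=\{S_1,\dots,S_m\}$ of subsets of $U$, and for each $S\in\mathcal{S}$ an integer covering requirement $K(S)\in\{1,\dots,|S|\}$. A solution is an ordering of the $n$ elements; $C_S$ denotes the position of the $K(S)$-th element of $S$ in the ordering, and the goal is to minimize $\sum_{S\in\mathcal{S}}C_S$. Write $[n]=\{1,\dots,n\}$. The LP has variables $x_{e,t}$ ($e\in U$, $t\in[n]$) and $y_{S,t}$ ($S\in\mathcal{S}$, $t\in[n]$): minimize $\sum_{t\in[n]}\sum_{S\in\mathcal{S}}(1-y_{S,t})$ subject to $\sum_{e\in U}x_{e,t}=1$ for all $t\in[n]$; $\sum_{t\in[n]}x_{e,t}=1$ for all $e\in U$; $\sum_{e\in S\setminus A}\sum_{t'<t}x_{e,t'}\ge (K(S)-|A|)\,y_{S,t}$ for all $S\in\mathcal{S}$, $A\subseteq S$, $t\in[n]$; and $x_{e,t},y_{S,t}\in[0,1]$.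
   Formalization: The optimal LP solution $x^*,y^*$ and the constant $Q$ are rational, and optimality is tested only against rational feasible solutions of the LP. -}

module Defs where

open import Data.Bool using (Bool; true; false; if_then_else_; _∧_; not)
open import Data.Nat using (ℕ; zero; suc; _+_; _*_; _∸_; _≤_; ⌊_/2⌋)
open import Data.Nat.Base using (_<ᵇ_; _≡ᵇ_)
open import Data.Fin using (Fin; toℕ)
import Data.Fin as F
open import Data.Fin.Subset using (Subset; ∣_∣; _⊆_)
open import Data.Vec using (lookup)
open import Data.Integer using (+_)
open import Data.Rational using (ℚ; 0ℚ; 1ℚ; _/_)
import Data.Rational as ℚ
open import Data.Product using (_×_)
open import Relation.Binary.PropositionalEquality using (_≡_)

ℕ→ℚ : ℕ → ℚ
ℕ→ℚ k = + k / 1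

sumFin : ∀ {n} → (Fin n → ℚ) → ℚ
sumFin {zero}  f = 0ℚ
sumFin {suc n} f = f F.zero ℚ.+ sumFin (λ i → f (F.suc i))

sumFT : (ℕ → ℚ) → ℕ → ℕ → ℚ
sumFT f a zero    = 0ℚ
sumFT f a (suc l) = f a ℚ.+ sumFT f (suc a) l

sumTo : (ℕ → ℚ) → ℕ → ℚ
sumTo f t = sumFT f 1 t

record Instance (n m : ℕ) : Set where
  field
    S     : Fin m → Subset n
    K     : Fin m → ℕ
    K-pos : ∀ i → 1 ≤ K i
    K-le  : ∀ i → K i ≤ ∣ S i ∣

open Instance public

-- LP variables. Time t ∈ [n] is represented by τ : Fin n with t = toℕ τ + 1.
XVar : ℕ → Set
XVar n = Fin n → Fin n → ℚ

YVar : ℕ → ℕ → Set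
YVar n m = Fin m → Fin n → ℚ

inUnit : ℚ → Set
inUnit q = (0ℚ ℚ.≤ q) × (q ℚ.≤ 1ℚ)

coverLHS : ∀ {n} → XVar n → Subset n → Subset n → Fin n → ℚ
coverLHS x S A τ =
  sumFin (λ e → if lookup S e ∧ not (lookup A e)
                then sumFin (λ τ' → if toℕ τ' <ᵇ toℕ τ then x e τ' else 0ℚ)
                else 0ℚ)

record Feasible {n m} (I : Instance n m) (x : XVar n) (y : YVar n m) : Set where
  field
    timeSum  : ∀ τ → sumFin (λ e → x e τ) ≡ 1ℚ
    elemSum  : ∀ e → sumFin (λ τ → x e τ) ≡ 1ℚ
    cover    : ∀ i (A : Subset n) τ → A ⊆ S I i →
               (ℕ→ℚ (K I i) ℚ.- ℕ→ℚ ∣ A ∣) ℚ.* y i τ ℚ.≤ coverLHS x (S I i) A τ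
    x-range  : ∀ e τ → inUnit (x e τ)
    y-range  : ∀ i τ → inUnit (y i τ)

objective : ∀ {n m} → YVar n m → ℚ
objective y = sumFin (λ τ → sumFin (λ i → 1ℚ ℚ.- y i τ))

record Optimal {n m} (I : Instance n m) (x : XVar n) (y : YVar n m) : Set where
  field
    feasible : Feasible I x y
    optimal  : ∀ x' y' → Feasible I x' y' → objective y ℚ.≤ objective y'

-- The doubling construction. A row (x_{e,t})_t is represented as a
-- function ℕ → ℚ on times t (only t ∈ [n] are meaningful; other times are 0).

-- time t (1-based) of a Fin-indexed row
lk0 : ∀ {n} → (Fin n → ℚ) → ℕ → ℚ
lk0 {zero}  f k       = 0ℚ
lk0 {suc n} f zero    = f F.zero
lk0 {suc n} f (suc k) = lk0 (λ i → f (F.suc i)) k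

atTime : ∀ {n} → (Fin n → ℚ) → ℕ → ℚ
atTime f zero    = 0ℚ
atTime f (suc k) = lk0 f k

step : (ℕ → ℚ) → ℕ → (ℕ → ℚ)
step f t s = if s ≡ᵇ (2 * t) then f s ℚ.+ f t else f s

run : (ℕ → ℚ) → ℕ → (ℕ → ℚ)
run f zero    = f
run f (suc k) = step (run f k) (suc k)

doubled : ∀ {n} → ℚ → XVar n → Fin n → ℕ → ℚ
doubled {n} Q xs e = run (λ t → Q ℚ.* atTime (xs e) t) ⌊ n /2⌋

xAt : ∀ {n} → XVar n → Fin n → ℕ → ℚ
xAt xs e = atTime (xs e)

-- Each step t adds the current x_t to x_{2t}, so time s receives contributions from
-- s/2, s/4, … and the prefix sums G of the doubled row obey G t = P t + G ⌊t/2⌋,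
-- where P is the prefix sum of the scaled row Q·x*. Nonnegativity of the steps gives
-- (iii); the recurrence at t and 2t says that the window (t, 2t] carries exactly
-- P (2t) ≥ P t, which is (ii); summed over the elements, P t = Q t, and unrolling the
-- recurrence by strong induction bounds G t by Q t + 2Q ⌊t/2⌋ ≤ 2Q t, which is (i).
module Submission where

open import Defs
open import Data.Nat using (ℕ; _≤_; ⌊_/2⌋; _+_)
open import Data.Fin using (Fin)
open import Data.Product using (_×_)
open import Data.Rational using (ℚ; 0ℚ) renaming (_<_ to _<ℚ_; _≤_ to _≤ℚ_; _*_ to _*ℚ_)

open import Data.Bool using (true; false)
open import Data.Empty using (⊥-elim)
import Data.Fin as Fin
open import Data.Integer as ℤ using (+≤+)
import Data.Integer.Properties as ℤP
open import Data.Nat as ℕ using (zero; suc; _*_; _<_; z≤n; s≤s)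
open import Data.Nat.Coprimality using (1-coprimeTo) renaming (sym to coprime-sym)
open import Data.Nat.Induction using (<-rec)
import Data.Nat.Properties as ℕP
open import Data.Product using (_,_; proj₁)
open import Data.Rational using (1ℚ; mkℚ; toℚᵘ; *≤*; nonNegative) renaming (_+_ to _+ℚ_)
import Data.Rational.Properties as ℚP
open import Data.Rational.Solver using (module +-*-Solver)
import Data.Rational.Unnormalised as ℚᵘ
import Data.Rational.Unnormalised.Properties as ℚᵘP
import Data.Sign as Sign
open import Data.Sum using (_⊎_; inj₁; inj₂)
open import Relation.Binary.PropositionalEquality
open import Relation.Nullary using (yes; no)
open import Algebra.Bundles using (CommutativeMonoid)
open import Algebra.Properties.CommutativeSemigroup
  (CommutativeMonoid.commutativeSemigroup ℚP.+-0-commutativeMonoid) using (interchange; xy∙z≈xz∙y)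
open import Algebra.Properties.Group ℚP.+-0-group using (∙-cancelʳ)

ℕ→ℚ≡mkℚ : ∀ k → ℕ→ℚ k ≡ mkℚ (ℤ.+ k) 0 (coprime-sym (1-coprimeTo k))
ℕ→ℚ≡mkℚ k = ℚP.normalize-coprime (coprime-sym (1-coprimeTo k))

ℕ→ℚ-homo-+ : ∀ a b → ℕ→ℚ (a + b) ≡ ℕ→ℚ a +ℚ ℕ→ℚ b
ℕ→ℚ-homo-+ a b =
  ℚP.toℚᵘ-injective
    (ℚᵘP.≃-trans unnormalised (ℚᵘP.≃-sym (ℚP.toℚᵘ-homo-+ (ℕ→ℚ a) (ℕ→ℚ b))))
  where
  +◃k*1≡+k : ∀ k → Sign.+ ℤ.◃ k ℕ.* 1 ≡ ℤ.+ k
  +◃k*1≡+k k = trans (ℤP.+◃n≡+n _) (cong ℤ.+_ (ℕP.*-identityʳ k))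

  unnormalised : toℚᵘ (ℕ→ℚ (a + b)) ℚᵘ.≃ (toℚᵘ (ℕ→ℚ a) ℚᵘ.+ toℚᵘ (ℕ→ℚ b))
  unnormalised rewrite ℕ→ℚ≡mkℚ a | ℕ→ℚ≡mkℚ b | ℕ→ℚ≡mkℚ (a + b) =
    ℚᵘ.*≡* (cong (ℤ._* ℤ.1ℤ)
      (trans (ℤP.pos-+ a b) (sym (cong₂ ℤ._+_ (+◃k*1≡+k a) (+◃k*1≡+k b)))))

ℕ→ℚ-mono-≤ : ∀ {a b} → a ≤ b → ℕ→ℚ a ≤ℚ ℕ→ℚ b
ℕ→ℚ-mono-≤ {a} {b} a≤b rewrite ℕ→ℚ≡mkℚ a | ℕ→ℚ≡mkℚ b =
  *≤* (ℤP.*-monoʳ-≤-nonNeg (ℤ.+ 1) (+≤+ a≤b))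

ℕ→ℚ-suc : ∀ k → ℕ→ℚ (suc k) ≡ ℕ→ℚ k +ℚ 1ℚ
ℕ→ℚ-suc k = trans (cong ℕ→ℚ (ℕP.+-comm 1 k)) (ℕ→ℚ-homo-+ k 1)

p≤p+q : ∀ {p q} → 0ℚ ≤ℚ q → p ≤ℚ p +ℚ q
p≤p+q {p} 0≤q = subst (_≤ℚ p +ℚ _) (ℚP.+-identityʳ p) (ℚP.+-monoʳ-≤ p 0≤q)

sumFT-split : ∀ g a l₁ l₂ → sumFT g a (l₁ + l₂) ≡ sumFT g a l₁ +ℚ sumFT g (a + l₁) l₂
sumFT-split g a zero l₂ =
  sym (trans (ℚP.+-identityˡ _) (cong (λ b → sumFT g b l₂) (ℕP.+-identityʳ a)))
sumFT-split g a (suc l₁) l₂ = begin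
  g a +ℚ sumFT g (suc a) (l₁ + l₂)
    ≡⟨ cong (g a +ℚ_) (sumFT-split g (suc a) l₁ l₂) ⟩
  g a +ℚ (sumFT g (suc a) l₁ +ℚ sumFT g (suc a + l₁) l₂)
    ≡⟨ sym (ℚP.+-assoc (g a) _ _) ⟩
  sumFT g a (suc l₁) +ℚ sumFT g (suc a + l₁) l₂
    ≡⟨ cong (λ b → sumFT g a (suc l₁) +ℚ sumFT g b l₂) (sym (ℕP.+-suc a l₁)) ⟩
  sumFT g a (suc l₁) +ℚ sumFT g (a + suc l₁) l₂ ∎
  where open ≡-Reasoning

sumTo-suc : ∀ g l → sumTo g (suc l) ≡ sumTo g l +ℚ g (suc l)
sumTo-suc g l = begin
  sumFT g 1 (suc l)                     ≡⟨ cong (sumFT g 1) (ℕP.+-comm 1 l) ⟩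
  sumFT g 1 (l + 1)                     ≡⟨ sumFT-split g 1 l 1 ⟩
  sumTo g l +ℚ (g (suc l) +ℚ 0ℚ)         ≡⟨ cong (sumTo g l +ℚ_) (ℚP.+-identityʳ _) ⟩
  sumTo g l +ℚ g (suc l)                ∎
  where open ≡-Reasoning

sumFT-cong : ∀ {g h} a l → (∀ s → a ≤ s → s < a + l → g s ≡ h s) → sumFT g a l ≡ sumFT h a l
sumFT-cong a zero    g≡h = refl
sumFT-cong a (suc l) g≡h = cong₂ _+ℚ_
  (g≡h a ℕP.≤-refl (ℕP.m<m+n a (s≤s z≤n)))
  (sumFT-cong (suc a) l (λ s a<s s<1+a+l →
    g≡h s (ℕP.<⇒≤ a<s) (ℕP.<-≤-trans s<1+a+l (ℕP.≤-reflexive (sym (ℕP.+-suc a l))))))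

sumFT-mono-≤ : ∀ {g h} a l → (∀ s → g s ≤ℚ h s) → sumFT g a l ≤ℚ sumFT h a l
sumFT-mono-≤ a zero    g≤h = ℚP.≤-refl
sumFT-mono-≤ a (suc l) g≤h = ℚP.+-mono-≤ (g≤h a) (sumFT-mono-≤ (suc a) l g≤h)

sumFT-nonNeg : ∀ {g} a l → (∀ s → 0ℚ ≤ℚ g s) → 0ℚ ≤ℚ sumFT g a l
sumFT-nonNeg a zero    0≤g = ℚP.≤-refl
sumFT-nonNeg a (suc l) 0≤g = ℚP.+-mono-≤ (0≤g a) (sumFT-nonNeg (suc a) l 0≤g)

sumFT-extend-≤ : ∀ {g} a l₁ l₂ → (∀ s → 0ℚ ≤ℚ g s) → sumFT g a l₁ ≤ℚ sumFT g a (l₁ + l₂)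
sumFT-extend-≤ {g} a l₁ l₂ 0≤g =
  subst (sumFT g a l₁ ≤ℚ_) (sym (sumFT-split g a l₁ l₂)) (p≤p+q (sumFT-nonNeg (a + l₁) l₂ 0≤g))

sumFT-scale : ∀ c g a l → sumFT (λ s → c *ℚ g s) a l ≡ c *ℚ sumFT g a l
sumFT-scale c g a zero    = sym (ℚP.*-zeroʳ c)
sumFT-scale c g a (suc l) =
  trans (cong (c *ℚ g a +ℚ_) (sumFT-scale c g (suc a) l)) (sym (ℚP.*-distribˡ-+ c _ _))

sumFT-const : ∀ c a l → sumFT (λ _ → c) a l ≡ c *ℚ ℕ→ℚ l
sumFT-const c a zero    = sym (ℚP.*-zeroʳ c)
sumFT-const c a (suc l) = begin
  c +ℚ sumFT (λ _ → c) (suc a) l  ≡⟨ cong (c +ℚ_) (sumFT-const c (suc a) l) ⟩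
  c +ℚ c *ℚ ℕ→ℚ l                 ≡⟨ solve 2 (λ c x → c :+ c :* x := c :* (x :+ con 1ℚ))
                                             refl c (ℕ→ℚ l) ⟩
  c *ℚ (ℕ→ℚ l +ℚ 1ℚ)              ≡⟨ cong (c *ℚ_) (sym (ℕ→ℚ-suc l)) ⟩
  c *ℚ ℕ→ℚ (suc l)                ∎
  where
  open ≡-Reasoning
  open +-*-Solver

sumFin-cong : ∀ {n} {f g : Fin n → ℚ} → (∀ i → f i ≡ g i) → sumFin f ≡ sumFin g
sumFin-cong {zero}  f≡g = refl
sumFin-cong {suc n} f≡g = cong₂ _+ℚ_ (f≡g Fin.zero) (sumFin-cong (λ i → f≡g (Fin.suc i)))

sumFin-+ : ∀ {n} (f g : Fin n → ℚ) → sumFin (λ i → f i +ℚ g i) ≡ sumFin f +ℚ sumFin g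
sumFin-+ {zero}  f g = refl
sumFin-+ {suc n} f g = begin
  (f₀ +ℚ g₀) +ℚ sumFin (λ i → f (Fin.suc i) +ℚ g (Fin.suc i))
    ≡⟨ cong ((f₀ +ℚ g₀) +ℚ_) (sumFin-+ (λ i → f (Fin.suc i)) (λ i → g (Fin.suc i))) ⟩
  (f₀ +ℚ g₀) +ℚ (sumFin (λ i → f (Fin.suc i)) +ℚ sumFin (λ i → g (Fin.suc i)))
    ≡⟨ interchange f₀ g₀ _ _ ⟩
  sumFin f +ℚ sumFin g ∎
  where
  open ≡-Reasoning
  f₀ = f Fin.zero
  g₀ = g Fin.zero

sumFin-scale : ∀ {n} c (f : Fin n → ℚ) → sumFin (λ i → c *ℚ f i) ≡ c *ℚ sumFin f
sumFin-scale {zero}  c f = sym (ℚP.*-zeroʳ c)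
sumFin-scale {suc n} c f =
  trans (cong (c *ℚ f Fin.zero +ℚ_) (sumFin-scale c (λ i → f (Fin.suc i)))) (sym (ℚP.*-distribˡ-+ c _ _))

⌊n/2⌋-parity : ∀ n → n ≡ 2 * ⌊ n /2⌋ ⊎ n ≡ suc (2 * ⌊ n /2⌋)
⌊n/2⌋-parity zero          = inj₁ refl
⌊n/2⌋-parity (suc zero)    = inj₂ refl
⌊n/2⌋-parity (suc (suc n)) with ⌊n/2⌋-parity n
... | inj₁ even = inj₁ (trans (cong (2 +_) even) (sym (ℕP.*-suc 2 ⌊ n /2⌋)))
... | inj₂ odd  = inj₂ (trans (cong (2 +_) odd) (cong suc (sym (ℕP.*-suc 2 ⌊ n /2⌋))))

odd≢even : ∀ u v → suc (2 * u) ≢ 2 * v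
odd≢even zero    zero    ()
odd≢even zero    (suc v) eq with ℕP.suc-injective (trans eq (ℕP.*-suc 2 v))
... | ()
odd≢even (suc u) zero    ()
odd≢even (suc u) (suc v) eq = odd≢even u v
  (ℕP.suc-injective (ℕP.suc-injective (trans (cong suc (sym (ℕP.*-suc 2 u))) (trans eq (ℕP.*-suc 2 v)))))

1+n<2*[1+n] : ∀ n → suc n < 2 * suc n
1+n<2*[1+n] n = ℕP.m<m+n (suc n) (s≤s z≤n)

step-≢2t : ∀ f t s → s ≢ 2 * t → step f t s ≡ f s
step-≢2t f t s s≢2t with s ℕ.≡ᵇ 2 * t | ℕP.≡ᵇ⇒≡ s (2 * t)
... | false | _    = refl
... | true  | s≡2t = ⊥-elim (s≢2t (s≡2t _))

step-2t : ∀ f t → step f t (2 * t) ≡ f (2 * t) +ℚ f t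
step-2t f t with 2 * t ℕ.≡ᵇ 2 * t | ℕP.≡⇒≡ᵇ (2 * t) (2 * t) refl
... | true  | _  = refl
... | false | ()

run-untouched : ∀ f k s → (∀ u → suc u ≤ k → s ≢ 2 * suc u) → run f k s ≡ f s
run-untouched f zero    s _        = refl
run-untouched f (suc k) s untouched = trans
  (step-≢2t (run f k) (suc k) s (untouched k ℕP.≤-refl))
  (run-untouched f k s (λ u u<k → untouched u (ℕP.m≤n⇒m≤1+n u<k)))

run-odd : ∀ f k u → run f k (suc (2 * u)) ≡ f (suc (2 * u))
run-odd f k u = run-untouched f k _ (λ v _ → odd≢even u (suc v))

run-double : ∀ f k u → suc u ≤ k → run f k (2 * suc u) ≡ f (2 * suc u) +ℚ run f k (suc u)
run-double f (suc k) u u<1+k with u ℕ.≟ k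
... | yes refl = begin
  step (run f u) (suc u) (2 * suc u)       ≡⟨ step-2t (run f u) (suc u) ⟩
  run f u (2 * suc u) +ℚ run f u (suc u)   ≡⟨ cong₂ _+ℚ_ (run-untouched f u _ not-yet-doubled)
                                                (sym (step-≢2t (run f u) (suc u) (suc u) 1+u≢2[1+u])) ⟩
  f (2 * suc u) +ℚ run f (suc u) (suc u)   ∎
  where
  open ≡-Reasoning
  1+u≢2[1+u] : suc u ≢ 2 * suc u
  1+u≢2[1+u] = ℕP.<⇒≢ (1+n<2*[1+n] u)
  not-yet-doubled : ∀ v → suc v ≤ u → 2 * suc u ≢ 2 * suc v
  not-yet-doubled v v<u eq = ℕP.<⇒≢ (s≤s v<u) (sym (ℕP.*-cancelˡ-≡ _ _ 2 eq))
... | no u≢k = begin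
  step (run f k) (suc k) (2 * suc u)       ≡⟨ step-≢2t (run f k) (suc k) _ 2[1+u]≢2[1+k] ⟩
  run f k (2 * suc u)                      ≡⟨ run-double f k u u<k ⟩
  f (2 * suc u) +ℚ run f k (suc u)         ≡⟨ cong (f (2 * suc u) +ℚ_)
                                                (step-≢2t (run f k) (suc k) (suc u) 1+u≢2[1+k]) ⟨
  f (2 * suc u) +ℚ run f (suc k) (suc u)   ∎
  where
  open ≡-Reasoning
  u<k : suc u ≤ k
  u<k = ℕP.≤∧≢⇒< (ℕP.≤-pred u<1+k) u≢k
  2[1+u]≢2[1+k] : 2 * suc u ≢ 2 * suc k
  2[1+u]≢2[1+k] eq = u≢k (ℕP.suc-injective (ℕP.*-cancelˡ-≡ _ _ 2 eq))
  1+u≢2[1+k] : suc u ≢ 2 * suc k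
  1+u≢2[1+k] = ℕP.<⇒≢ (ℕP.<-≤-trans (s≤s u<k) (ℕP.<⇒≤ (1+n<2*[1+n] k)))

run-≥ : ∀ {f} → (∀ s → 0ℚ ≤ℚ f s) → ∀ k s → f s ≤ℚ run f k s
run-≥ 0≤f zero    s = ℚP.≤-refl
run-≥ 0≤f (suc k) s with s ℕ.≡ᵇ 2 * suc k
... | true  = ℚP.≤-trans (run-≥ 0≤f k s) (p≤p+q (ℚP.≤-trans (0≤f (suc k)) (run-≥ 0≤f k (suc k))))
... | false = run-≥ 0≤f k s

sumFin-run : ∀ {n} (g : Fin n → ℕ → ℚ) k s →
             sumFin (λ e → run (g e) k s) ≡ run (λ s → sumFin (λ e → g e s)) k s
sumFin-run g zero    s = refl
sumFin-run g (suc k) s with s ℕ.≡ᵇ 2 * suc k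
... | true  = trans (sumFin-+ (λ e → run (g e) k s) (λ e → run (g e) k (suc k)))
                    (cong₂ _+ℚ_ (sumFin-run g k s) (sumFin-run g k (suc k)))
... | false = sumFin-run g k s

module _ (f : ℕ → ℚ) (k : ℕ) where
  private
    r = run f k

  sumTo-run-odd : ∀ u → sumTo r (suc (2 * u)) ≡ sumTo r (2 * u) +ℚ f (suc (2 * u))
  sumTo-run-odd u = trans (sumTo-suc r (2 * u)) (cong (sumTo r (2 * u) +ℚ_) (run-odd f k u))

  sumTo-run-double : ∀ u → u ≤ k → sumTo r (2 * u) ≡ sumTo f (2 * u) +ℚ sumTo r u
  sumTo-run-double zero    _   = sym (ℚP.+-identityʳ 0ℚ)
  sumTo-run-double (suc u) u<k = begin
    sumTo r (2 * suc u)
      ≡⟨ cong (sumTo r) (ℕP.*-suc 2 u) ⟩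
    sumTo r (suc (suc m))
      ≡⟨ trans (sumTo-suc r (suc m)) (cong₂ _+ℚ_ (sumTo-run-odd u) at-2[1+u]) ⟩
    (sumTo r m +ℚ f (suc m)) +ℚ (f (suc (suc m)) +ℚ r (suc u))
      ≡⟨ cong (λ x → (x +ℚ f (suc m)) +ℚ (f (suc (suc m)) +ℚ r (suc u)))
              (sumTo-run-double u (ℕP.<⇒≤ u<k)) ⟩
    ((sumTo f m +ℚ sumTo r u) +ℚ f (suc m)) +ℚ (f (suc (suc m)) +ℚ r (suc u))
      ≡⟨ solve 5 (λ a b c d e → ((a :+ b) :+ c) :+ (d :+ e) := ((a :+ c) :+ d) :+ (b :+ e)) refl
           (sumTo f m) (sumTo r u) (f (suc m)) (f (suc (suc m))) (r (suc u)) ⟩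
    ((sumTo f m +ℚ f (suc m)) +ℚ f (suc (suc m))) +ℚ (sumTo r u +ℚ r (suc u))
      ≡⟨ sym (cong₂ _+ℚ_ (trans (sumTo-suc f (suc m)) (cong (_+ℚ f (suc (suc m))) (sumTo-suc f m)))
                         (sumTo-suc r u)) ⟩
    sumTo f (suc (suc m)) +ℚ sumTo r (suc u)
      ≡⟨ cong (λ s → sumTo f s +ℚ sumTo r (suc u)) (sym (ℕP.*-suc 2 u)) ⟩
    sumTo f (2 * suc u) +ℚ sumTo r (suc u) ∎
    where
    open ≡-Reasoning
    open +-*-Solver
    m = 2 * u
    at-2[1+u] : r (suc (suc m)) ≡ f (suc (suc m)) +ℚ r (suc u)
    at-2[1+u] = subst (λ s → r s ≡ f s +ℚ r (suc u)) (ℕP.*-suc 2 u) (run-double f k u u<k)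

  sumTo-run-double+1 : ∀ u → u ≤ k → sumTo r (suc (2 * u)) ≡ sumTo f (suc (2 * u)) +ℚ sumTo r u
  sumTo-run-double+1 u u≤k = begin
    sumTo r (suc (2 * u))
      ≡⟨ sumTo-run-odd u ⟩
    sumTo r (2 * u) +ℚ f (suc (2 * u))
      ≡⟨ cong (_+ℚ f (suc (2 * u))) (sumTo-run-double u u≤k) ⟩
    (sumTo f (2 * u) +ℚ sumTo r u) +ℚ f (suc (2 * u))
      ≡⟨ xy∙z≈xz∙y (sumTo f (2 * u)) (sumTo r u) (f (suc (2 * u))) ⟩
    (sumTo f (2 * u) +ℚ f (suc (2 * u))) +ℚ sumTo r u
      ≡⟨ cong (_+ℚ sumTo r u) (sumTo-suc f (2 * u)) ⟨
    sumTo f (suc (2 * u)) +ℚ sumTo r u ∎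
    where open ≡-Reasoning

  sumTo-run-halving : ∀ t → ⌊ t /2⌋ ≤ k → sumTo r t ≡ sumTo f t +ℚ sumTo r ⌊ t /2⌋
  sumTo-run-halving t h≤k with ⌊n/2⌋-parity t
  ... | inj₁ even = subst (λ s → sumTo r s ≡ sumTo f s +ℚ sumTo r ⌊ t /2⌋) (sym even)
                          (sumTo-run-double ⌊ t /2⌋ h≤k)
  ... | inj₂ odd  = subst (λ s → sumTo r s ≡ sumTo f s +ℚ sumTo r ⌊ t /2⌋) (sym odd)
                          (sumTo-run-double+1 ⌊ t /2⌋ h≤k)

  sumFT-run-window : ∀ t → t ≤ k → sumFT r (t + 1) t ≡ sumTo f (t + t)
  sumFT-run-window t t≤k = ∙-cancelʳ (sumTo r t) _ _ (begin
    sumFT r (t + 1) t +ℚ sumTo r t   ≡⟨ ℚP.+-comm _ (sumTo r t) ⟩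
    sumTo r t +ℚ sumFT r (t + 1) t   ≡⟨ cong (λ a → sumTo r t +ℚ sumFT r a t) (ℕP.+-comm t 1) ⟩
    sumTo r t +ℚ sumFT r (1 + t) t   ≡⟨ sym (sumFT-split r 1 t t) ⟩
    sumTo r (t + t)                  ≡⟨ cong (sumTo r) (sym 2t≡t+t) ⟩
    sumTo r (2 * t)                  ≡⟨ sumTo-run-double t t≤k ⟩
    sumTo f (2 * t) +ℚ sumTo r t     ≡⟨ cong (λ s → sumTo f s +ℚ sumTo r t) 2t≡t+t ⟩
    sumTo f (t + t) +ℚ sumTo r t     ∎)
    where
    open ≡-Reasoning
    2t≡t+t : 2 * t ≡ t + t
    2t≡t+t = cong (t +_) (ℕP.+-identityʳ t)

halving-bound : ∀ (G : ℕ → ℚ) (Q : ℚ) (N : ℕ) → 0ℚ ≤ℚ Q → G 0 ≤ℚ 0ℚ →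
                (∀ t → suc t ≤ N → G (suc t) ≤ℚ Q *ℚ ℕ→ℚ (suc t) +ℚ G ⌊ suc t /2⌋) →
                ∀ t → t ≤ N → G t ≤ℚ (Q +ℚ Q) *ℚ ℕ→ℚ t
halving-bound G Q N 0≤Q G0≤0 recurrence = <-rec (λ t → t ≤ N → G t ≤ℚ (Q +ℚ Q) *ℚ ℕ→ℚ t) bound
  where
  bound : ∀ t → (∀ {s} → s < t → s ≤ N → G s ≤ℚ (Q +ℚ Q) *ℚ ℕ→ℚ s) →
          t ≤ N → G t ≤ℚ (Q +ℚ Q) *ℚ ℕ→ℚ t
  bound zero    _  _     = ℚP.≤-trans G0≤0 (ℚP.≤-reflexive (sym (ℚP.*-zeroʳ (Q +ℚ Q))))
  bound (suc t) ih 1+t≤N = begin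
    G (suc t)                          ≤⟨ recurrence t 1+t≤N ⟩
    Q *ℚ T +ℚ G h                      ≤⟨ ℚP.+-monoʳ-≤ (Q *ℚ T) (ih (ℕP.⌊n/2⌋<n t) h≤N) ⟩
    Q *ℚ T +ℚ (Q +ℚ Q) *ℚ ℕ→ℚ h        ≡⟨ cong (Q *ℚ T +ℚ_) 2Q*h≡Q*[h+h] ⟩
    Q *ℚ T +ℚ Q *ℚ ℕ→ℚ (h + h)         ≤⟨ ℚP.+-monoʳ-≤ (Q *ℚ T)
                                            (ℚP.*-monoˡ-≤-nonNeg Q {{nonNegative 0≤Q}} (ℕ→ℚ-mono-≤ h+h≤1+t)) ⟩
    Q *ℚ T +ℚ Q *ℚ T                   ≡⟨ ℚP.*-distribʳ-+ T Q Q ⟨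
    (Q +ℚ Q) *ℚ T                      ∎
    where
    open ℚP.≤-Reasoning
    open +-*-Solver
    T = ℕ→ℚ (suc t)
    h = ⌊ suc t /2⌋
    h≤N : h ≤ N
    h≤N = ℕP.≤-trans (ℕP.⌊n/2⌋≤n (suc t)) 1+t≤N
    h+h≤1+t : h + h ≤ suc t
    h+h≤1+t = ℕP.≤-trans (ℕP.+-monoʳ-≤ h (ℕP.⌊n/2⌋≤⌈n/2⌉ (suc t)))
                         (ℕP.≤-reflexive (ℕP.⌊n/2⌋+⌈n/2⌉≡n (suc t)))
    2Q*h≡Q*[h+h] : (Q +ℚ Q) *ℚ ℕ→ℚ h ≡ Q *ℚ ℕ→ℚ (h + h)
    2Q*h≡Q*[h+h] = trans (solve 2 (λ q x → (q :+ q) :* x := q :* (x :+ x)) refl Q (ℕ→ℚ h))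
                         (cong (Q *ℚ_) (sym (ℕ→ℚ-homo-+ h h)))

lk0-fromℕ< : ∀ {n} (f : Fin n → ℚ) {k} (k<n : k < n) → lk0 f k ≡ f (Fin.fromℕ< k<n)
lk0-fromℕ< {suc n} f {zero}  _         = refl
lk0-fromℕ< {suc n} f {suc k} (s≤s k<n) = lk0-fromℕ< (λ i → f (Fin.suc i)) k<n

lk0-nonNeg : ∀ {n} {f : Fin n → ℚ} → (∀ i → 0ℚ ≤ℚ f i) → ∀ k → 0ℚ ≤ℚ lk0 f k
lk0-nonNeg {zero}              _   _       = ℚP.≤-refl
lk0-nonNeg {suc n}             0≤f zero    = 0≤f Fin.zero
lk0-nonNeg {suc n} {f = f}     0≤f (suc k) =
  lk0-nonNeg {f = λ i → f (Fin.suc i)} (λ i → 0≤f (Fin.suc i)) k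

atTime-nonNeg : ∀ {n} {f : Fin n → ℚ} → (∀ i → 0ℚ ≤ℚ f i) → ∀ t → 0ℚ ≤ℚ atTime f t
atTime-nonNeg 0≤f zero    = ℚP.≤-refl
atTime-nonNeg 0≤f (suc k) = lk0-nonNeg 0≤f k

module _ {n m} {I : Instance n m} {xs : XVar n} {ys : YVar n m}
         (feasible : Feasible I xs ys) (Q : ℚ) (0≤Q : 0ℚ ≤ℚ Q) where
  open Feasible feasible

  private
    row : Fin n → ℕ → ℚ
    row e t = Q *ℚ xAt xs e t

    row-nonNeg : ∀ e s → 0ℚ ≤ℚ row e s
    row-nonNeg e s = subst (_≤ℚ row e s) (ℚP.*-zeroʳ Q)
      (ℚP.*-monoˡ-≤-nonNeg Q {{nonNegative 0≤Q}} (atTime-nonNeg (λ τ → proj₁ (x-range e τ)) s))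

    sumTo-row : ∀ e t → sumTo (row e) t ≡ Q *ℚ sumTo (xAt xs e) t
    sumTo-row e t = sumFT-scale Q (xAt xs e) 1 t

    column : ℕ → ℚ
    column s = sumFin (λ e → row e s)

    column-at : ∀ j → j < n → column (suc j) ≡ Q
    column-at j j<n = begin
      sumFin (λ e → Q *ℚ lk0 (xs e) j)  ≡⟨ sumFin-scale Q (λ e → lk0 (xs e) j) ⟩
      Q *ℚ sumFin (λ e → lk0 (xs e) j)  ≡⟨ cong (Q *ℚ_) (sumFin-cong (λ e → lk0-fromℕ< (xs e) j<n)) ⟩
      Q *ℚ sumFin (λ e → xs e τ)         ≡⟨ cong (Q *ℚ_) (timeSum τ) ⟩
      Q *ℚ 1ℚ                            ≡⟨ ℚP.*-identityʳ Q ⟩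
      Q                                  ∎
      where
      open ≡-Reasoning
      τ = Fin.fromℕ< j<n

    sumTo-column : ∀ t → t ≤ n → sumTo column t ≡ Q *ℚ ℕ→ℚ t
    sumTo-column t t≤n = trans
      (sumFT-cong 1 t (λ { (suc j) _ (s≤s j<t) → column-at j (ℕP.<-≤-trans j<t t≤n) }))
      (sumFT-const Q 1 t)

  doubled-prefix-≥ : ∀ e t → Q *ℚ sumTo (xAt xs e) t ≤ℚ sumTo (doubled Q xs e) t
  doubled-prefix-≥ e t = subst (_≤ℚ sumTo (doubled Q xs e) t) (sumTo-row e t)
    (sumFT-mono-≤ 1 t (run-≥ (row-nonNeg e) ⌊ n /2⌋))

  doubled-window-≥ : ∀ e t → t ≤ ⌊ n /2⌋ →
                     Q *ℚ sumTo (xAt xs e) t ≤ℚ sumFT (doubled Q xs e) (t + 1) t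
  doubled-window-≥ e t t≤n/2 = subst₂ _≤ℚ_
    (sumTo-row e t) (sym (sumFT-run-window (row e) ⌊ n /2⌋ t t≤n/2))
    (sumFT-extend-≤ 1 t t (row-nonNeg e))

  doubled-total-prefix-≤ : ∀ t → t ≤ n →
    sumTo (λ t' → sumFin (λ e → doubled Q xs e t')) t ≤ℚ (ℕ→ℚ 2 *ℚ Q) *ℚ ℕ→ℚ t
  doubled-total-prefix-≤ t t≤n = subst₂ _≤ℚ_
    (sumFT-cong 1 t (λ s _ _ → sym (sumFin-run row ⌊ n /2⌋ s)))
    -- ℕ→ℚ 2 is a closed term that normalises to 1ℚ +ℚ 1ℚ.
    (cong (_*ℚ ℕ→ℚ t) (solve 1 (λ q → q :+ q := (con 1ℚ :+ con 1ℚ) :* q) refl Q))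
    (halving-bound G Q n 0≤Q ℚP.≤-refl recurrence t t≤n)
    where
    open +-*-Solver
    G = sumTo (run column ⌊ n /2⌋)
    recurrence : ∀ t → suc t ≤ n → G (suc t) ≤ℚ Q *ℚ ℕ→ℚ (suc t) +ℚ G ⌊ suc t /2⌋
    recurrence t 1+t≤n = ℚP.≤-reflexive (trans
      (sumTo-run-halving column ⌊ n /2⌋ (suc t) (ℕP.⌊n/2⌋-mono 1+t≤n))
      (cong (_+ℚ G ⌊ suc t /2⌋) (sumTo-column (suc t) 1+t≤n)))

lemma1 : ∀ {n m} (I : Instance n m) (xs : XVar n) (ys : YVar n m) →
         Optimal I xs ys → (Q : ℚ) → 0ℚ <ℚ Q →
         let x = doubled Q xs in
         (∀ (t : ℕ) → 1 ≤ t → t ≤ n →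
            sumTo (λ t' → sumFin (λ e → x e t')) t ≤ℚ (ℕ→ℚ 2 *ℚ Q) *ℚ ℕ→ℚ t)
         × (∀ (e : Fin n) (t : ℕ) → 1 ≤ t → t ≤ ⌊ n /2⌋ →
            Q *ℚ sumTo (xAt xs e) t ≤ℚ sumFT (x e) (t + 1) t)
         × (∀ (e : Fin n) (t : ℕ) → 1 ≤ t → t ≤ n →
            Q *ℚ sumTo (xAt xs e) t ≤ℚ sumTo (x e) t)
lemma1 I xs ys optimal Q 0<Q =
    (λ t _ → doubled-total-prefix-≤ feasible Q 0≤Q t)
  , (λ e t _ → doubled-window-≥ feasible Q 0≤Q e t)
  , (λ e t _ _ → doubled-prefix-≥ feasible Q 0≤Q e t)
  where
  feasible = Optimal.feasible optimal
  0≤Q = ℚP.<⇒≤ 0<Q
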